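{- Let $q$ and $e$ be coprime positive integers with $1<q<e$, and set $e_1 := \gcd(e,q-1)$. If $e < e_1^2 + 2e_1$, then $m(q,e) = e_1$.
   Context: For coprime positive integers $q,e$, $m(q,e)$ denotes the least positive integer $t$ such that there exist nonnegative integers $a_1,\ldots,a_t$ (repetitions allowed) with $q^{a_1}+\cdots+q^{a_t} \equiv 0 \pmod e$. -}

module Defs where

open import Data.Nat using (ℕ; _^_; _<_; _≤_)
open import Data.Nat.Divisibility using (_∣_)
open import Data.Nat.ListAction using (sum)
open import Data.List using (List; length; map)
open import Data.Product using (∃; _×_)
open import Relation.Binary.PropositionalEquality using (_≡_)
open import Relation.Nullary using (¬_)

Admissible : ℕ → ℕ → ℕ → Set
Admissible q e t = ∃ λ (as : List ℕ) → length as ≡ t × e ∣ sum (map (q ^_) as)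

IsM : ℕ → ℕ → ℕ → Set
IsM q e t = 1 ≤ t × Admissible q e t × (∀ s → 1 ≤ s → s < t → ¬ Admissible q e s)

{-# OPTIONS --safe #-}
module Submission where

open import Defs
open import Data.Nat using (ℕ; _+_; _*_; _∸_; _<_; _≤_; _^_; zero; suc; z≤n; s≤s; NonZero; >-nonZero)
open import Data.Nat.Properties
open import Data.Nat.Divisibility
open import Data.Nat.DivMod using (_%_; _/_; m≡m%n+[m/n]*n; m%n<n)
open import Data.Nat.GCD using (gcd; gcd[m,n]∣m; gcd[m,n]∣n; gcd-GCD; module Bézout)
open import Data.Nat.Coprimality using (Coprime)
open import Data.Nat.ListAction using (sum)
open import Data.Nat.Solver using (module +-*-Solver)
open import Data.List using (List; []; _∷_; length; map)
open import Data.Product using (∃-syntax; _×_; _,_)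
open import Relation.Binary.PropositionalEquality
open import Relation.Nullary using (¬_)
open +-*-Solver

-- Write q = 1 + a and d = gcd(e, a). Every power of q is 1 modulo a, so a sum
-- of s powers of q is s modulo d; since d ∣ e, such a sum can vanish modulo e
-- only if d ∣ s, whence m(q,e) ≥ d. Conversely, write e = f d. Bézout gives y
-- with e ∣ d + y a, and y may be reduced modulo f because e ∣ f a. The bound
-- e < d² + 2d means f ≤ d + 1, so the reduced multiplier is some x ≤ d, and
-- x copies of q together with d − x copies of 1 sum to d + x a.

suc^≡1+* : ∀ a n → ∃[ k ] suc a ^ n ≡ 1 + k * a
suc^≡1+* a zero = 0 , refl
suc^≡1+* a (suc n) with suc^≡1+* a n
... | k , eq = 1 + k + k * a , (begin
  suc a * suc a ^ n         ≡⟨ cong (suc a *_) eq ⟩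
  suc a * (1 + k * a)       ≡⟨ solve 2 (λ a k → (con 1 :+ a) :* (con 1 :+ k :* a)
                                            := con 1 :+ (con 1 :+ k :+ k :* a) :* a) refl a k ⟩
  1 + (1 + k + k * a) * a   ∎)
  where open ≡-Reasoning

sum-suc^≡length+* : ∀ a as → ∃[ K ] sum (map (suc a ^_) as) ≡ length as + K * a
sum-suc^≡length+* a [] = 0 , refl
sum-suc^≡length+* a (n ∷ as) with suc^≡1+* a n | sum-suc^≡length+* a as
... | k , eqₙ | K , eqₐₛ = k + K , (begin
  suc a ^ n + sum (map (suc a ^_) as)  ≡⟨ cong₂ _+_ eqₙ eqₐₛ ⟩
  1 + k * a + (length as + K * a)      ≡⟨ solve 4 (λ a k l K → con 1 :+ k :* a :+ (l :+ K :* a)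
                                                      := con 1 :+ l :+ (k :+ K) :* a) refl a k (length as) K ⟩
  suc (length as) + (k + K) * a        ∎)
  where open ≡-Reasoning

∣sum-suc^⇒∣length : ∀ {a d} as → d ∣ a → d ∣ sum (map (suc a ^_) as) → d ∣ length as
∣sum-suc^⇒∣length {a} {d} as d∣a d∣sum with sum-suc^≡length+* a as
... | K , eq = ∣m+n∣m⇒∣n d∣K*a+length (∣-trans d∣a (n∣m*n K))
  where
  d∣K*a+length : d ∣ K * a + length as
  d∣K*a+length = subst (d ∣_) (trans eq (+-comm (length as) (K * a))) d∣sum

sum-suc^-of-bits : ∀ a d x → x ≤ d →
  ∃[ as ] length as ≡ d × sum (map (suc a ^_) as) ≡ d + x * a
sum-suc^-of-bits a zero .zero z≤n = [] , refl , refl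
sum-suc^-of-bits a (suc d) zero z≤n with sum-suc^-of-bits a d zero z≤n
... | as , len , eq = 0 ∷ as , cong suc len , cong suc eq
sum-suc^-of-bits a (suc d) (suc x) (s≤s x≤d) with sum-suc^-of-bits a d x x≤d
... | as , len , eq = 1 ∷ as , cong suc len , (begin
  suc a ^ 1 + sum (map (suc a ^_) as)  ≡⟨ cong (suc a ^ 1 +_) eq ⟩
  suc a * 1 + (d + x * a)              ≡⟨ solve 3 (λ a d x → (con 1 :+ a) :* con 1 :+ (d :+ x :* a)
                                                      := con 1 :+ d :+ (a :+ x :* a)) refl a d x ⟩
  suc d + suc x * a                    ∎)
  where open ≡-Reasoning

-- The "-+" case of Bézout says d ≡ y a modulo f d, and then
-- d + (f ∸ 1) y a ≡ f d ≡ 0.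
bézout⇒∣d+* : ∀ {a d} f .{{_ : NonZero f}} → Bézout.Identity d (f * d) a →
  ∃[ y ] f * d ∣ d + y * a
bézout⇒∣d+* f (Bézout.+- x y eq) = y , divides x eq
bézout⇒∣d+* {a} {d} (suc f) (Bézout.-+ x y eq) = f * y , divides (1 + f * x) (begin
  d + f * y * a                      ≡⟨ cong (d +_) (*-assoc f y a) ⟩
  d + f * (y * a)                    ≡⟨ cong (λ t → d + f * t) (sym eq) ⟩
  d + f * (d + x * (suc f * d))      ≡⟨ solve 3 (λ d f x → d :+ f :* (d :+ x :* ((con 1 :+ f) :* d))
                                                    := (con 1 :+ f :* x) :* ((con 1 :+ f) :* d)) refl d f x ⟩
  (1 + f * x) * (suc f * d)          ∎)
  where open ≡-Reasoning

∣+*-reduce-% : ∀ c d f k y .{{_ : NonZero f}} →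
  f * d ∣ c + y * (k * d) → f * d ∣ c + (y % f) * (k * d)
∣+*-reduce-% c d f k y fd∣ = ∣m+n∣m⇒∣n (subst (f * d ∣_) split fd∣) (n∣m*n (y / f * k))
  where
  open ≡-Reasoning
  split : c + y * (k * d) ≡ y / f * k * (f * d) + (c + (y % f) * (k * d))
  split = begin
    c + y * (k * d)                              ≡⟨ cong (λ t → c + t * (k * d)) (m≡m%n+[m/n]*n y f) ⟩
    c + (y % f + y / f * f) * (k * d)            ≡⟨ solve 6 (λ c d r q f k → c :+ (r :+ q :* f) :* (k :* d)
                                                      := q :* k :* (f :* d) :+ (c :+ r :* (k :* d)))
                                                      refl c d (y % f) (y / f) f k ⟩
    y / f * k * (f * d) + (c + (y % f) * (k * d)) ∎

admissible-cofactor : ∀ a d f .{{_ : NonZero f}} → d ∣ a → Bézout.Identity d (f * d) a →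
  f ≤ suc d → Admissible (suc a) (f * d) d
admissible-cofactor .(k * d) d f (divides k refl) bézout f≤1+d
  with bézout⇒∣d+* f bézout
... | y , fd∣d+y*a with sum-suc^-of-bits (k * d) d (y % f) (m<1+n⇒m≤n (≤-trans (m%n<n y f) f≤1+d))
... | as , len , eq = as , len , subst (f * d ∣_) (sym eq) (∣+*-reduce-% d d f k y fd∣d+y*a)

admissible-gcd : ∀ a e .{{_ : NonZero e}} → e < gcd e a * gcd e a + 2 * gcd e a →
  Admissible (suc a) e (gcd e a)
admissible-gcd a e bound =
  subst (λ m → Admissible (suc a) m d) (sym e≡f*d)
    (admissible-cofactor a d f (gcd[m,n]∣n e a) bézout f≤1+d)
  where
  d = gcd e a
  d∣e = gcd[m,n]∣m e a
  f = quotient d∣e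
  e≡f*d : e ≡ f * d
  e≡f*d = m∣n⇒n≡quotient*m d∣e
  instance
    f≢0 : NonZero f
    f≢0 = quotient≢0 d∣e
  bézout : Bézout.Identity d (f * d) a
  bézout = subst (λ m → Bézout.Identity d m a) e≡f*d (Bézout.identity (gcd-GCD e a))
  f≤1+d : f ≤ suc d
  f≤1+d = m<1+n⇒m≤n (*-cancelʳ-< d f (2 + d)
    (subst₂ _<_ e≡f*d (solve 1 (λ d → d :* d :+ con 2 :* d := (con 2 :+ d) :* d) refl d) bound))

admissible⇒gcd∣ : ∀ a e s → Admissible (suc a) e s → gcd e a ∣ s
admissible⇒gcd∣ a e s (as , refl , e∣sum) =
  ∣sum-suc^⇒∣length as (gcd[m,n]∣n e a) (∣-trans (gcd[m,n]∣m e a) e∣sum)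

m<n*n+2*n⇒0<n : ∀ {m n} → m < n * n + 2 * n → 0 < n
m<n*n+2*n⇒0<n {n = suc n} _ = s≤s z≤n

lemma3 : (q e : ℕ) → Coprime q e → 1 < q → q < e →
    e < gcd e (q ∸ 1) * gcd e (q ∸ 1) + 2 * gcd e (q ∸ 1) →
    IsM q e (gcd e (q ∸ 1))
lemma3 (suc (suc a)) e _ _ q<e bound =
  m<n*n+2*n⇒0<n bound , admissible-gcd (suc a) e bound , below-gcd-inadmissible
  where
  instance
    e≢0 : NonZero e
    e≢0 = >-nonZero (<-trans (s≤s z≤n) q<e)
  below-gcd-inadmissible : ∀ s → 1 ≤ s → s < gcd e (suc a) → ¬ Admissible (suc (suc a)) e s
  below-gcd-inadmissible s 1≤s s<d adm =
    <⇒≱ s<d (∣⇒≤ {{>-nonZero 1≤s}} (admissible⇒gcd∣ (suc a) e s adm))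
lemma3 (suc zero) e _ (s≤s ()) _ _
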